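{- Let $k\ge 2$ and let $c:\mathbb{N}\to\{R,G,B\}$ be rainbow-free for $x-y=z^k$ with dominant color $R$. Suppose $c(j)=B$, and let $i,\ell\in\mathbb{N}$ be such that $c(i)=c(i+1)=\dots=c(i+\ell-1)=G$. Then the string of length $\ell$ at position $i+j^k$ is monochromatic of color $B$ or of color $G$, and, provided $i-j^k\ge 1$, the string of length $\ell$ at position $i-j^k$ is monochromatic of color $B$ or of color $G$.
   Context: Here $\mathbb{N}=\{1,2,\dots\}$. A rainbow solution to $x-y=z^k$ is an ordered triple $(a_1,a_2,a_3)$ of positive integers with $a_1-a_2=a_3^k$ and $c(a_1),c(a_2),c(a_3)$ pairwise distinct; rainbow-free means no such triple exists. A string of length $\ell$ at position $i$ is $\{i,\dots,i+\ell-1\}$; it is monochromatic if all its elements have the same color and bichromatic if it contains exactly two colors. A color is dominant if every bichromatic string contains an element of that color. -}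

module Defs where

open import Data.Nat using (ℕ; zero; suc; _+_; _∸_; _^_; _≤_; _<_)
open import Data.Product using (_×_; ∃-syntax; _,_)
open import Relation.Binary.PropositionalEquality using (_≡_; _≢_)
open import Relation.Nullary using (¬_)
open import Data.Sum using (_⊎_)

data Color : Set where
  R G B : Color

-- A colouring of ℕ = {1,2,...}. We use Agda's ℕ (which contains 0) as the
-- index type; the value at 0 is irrelevant: all definitions only inspect
-- positive arguments.
Coloring : Set
Coloring = ℕ → Color

IsRainbowSolution : ℕ → Coloring → ℕ → ℕ → ℕ → Set
IsRainbowSolution k c a₁ a₂ a₃ =
  1 ≤ a₁ × 1 ≤ a₂ × 1 ≤ a₃ × a₁ ≡ a₂ + a₃ ^ k ×
  c a₁ ≢ c a₂ × c a₁ ≢ c a₃ × c a₂ ≢ c a₃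

RainbowFree : ℕ → Coloring → Set
RainbowFree k c = ∀ a₁ a₂ a₃ → ¬ IsRainbowSolution k c a₁ a₂ a₃

InString : ℕ → ℕ → ℕ → Set
InString i ℓ x = i ≤ x × x < i + ℓ

Occurs : Coloring → ℕ → ℕ → Color → Set
Occurs c i ℓ col = ∃[ x ] (InString i ℓ x × c x ≡ col)

MonochromaticOf : Coloring → ℕ → ℕ → Color → Set
MonochromaticOf c i ℓ col = ∀ x → InString i ℓ x → c x ≡ col

Bichromatic : Coloring → ℕ → ℕ → Set
Bichromatic c i ℓ = ∃[ p ] ∃[ q ]
  (p ≢ q × Occurs c i ℓ p × Occurs c i ℓ q ×
   (∀ x → InString i ℓ x → c x ≡ p ⊎ c x ≡ q))

Dominant : Coloring → Color → Set
Dominant c col = ∀ i ℓ → 1 ≤ i → Bichromatic c i ℓ → Occurs c i ℓ col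

{-# OPTIONS --safe #-}
-- For x in a shifted string, x and x ∓ j^k differ by j^k; the unshifted
-- partner is G and j is B, so rainbow-freeness excludes c x ≡ R.  A string
-- avoiding R can show at most the two colours G and B, and if it showed both
-- it would be a bichromatic string without the dominant colour R.
module Submission where

open import Defs
open import Data.Nat using (ℕ; _+_; _∸_; _^_; _≤_; _<_)
open import Data.Nat.Properties
  using (≤-refl; ≤-trans; <⇒≤; m≤m+n; m<m+n; +-monoˡ-≤; +-monoˡ-<; +-cancelʳ-≤; +-cancelʳ-<;
         m∸n+n≡m; m≤n+m; m∸n≢0⇒n<m; n>0⇒n≢0; +-commutativeSemigroup)
open import Algebra.Properties.CommutativeSemigroup +-commutativeSemigroup using (xy∙z≈xz∙y)
open import Data.Sum using (_⊎_; inj₁; inj₂)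
open import Data.Empty using (⊥)
open import Data.Product using (_×_; _,_; proj₁)
open import Relation.Binary.Definitions using (DecidableEquality)
open import Relation.Binary.PropositionalEquality
open import Relation.Nullary using (yes; no; contradiction)

_≟_ : DecidableEquality Color
R ≟ R = yes refl
G ≟ G = yes refl
B ≟ B = yes refl
R ≟ G = no λ ()
R ≟ B = no λ ()
G ≟ R = no λ ()
G ≟ B = no λ ()
B ≟ R = no λ ()
B ≟ G = no λ ()

≢R⇒≡B⊎≡G : ∀ {a} → a ≢ R → a ≡ B ⊎ a ≡ G
≢R⇒≡B⊎≡G {R} a≢R = contradiction refl a≢R
≢R⇒≡B⊎≡G {G} _   = inj₂ refl
≢R⇒≡B⊎≡G {B} _   = inj₁ refl

≢R-pair-exhaustive : ∀ {a b d} → a ≢ R → b ≢ R → a ≢ b → d ≢ R → d ≡ a ⊎ d ≡ b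
≢R-pair-exhaustive {G} {B} {G} _ _ _ _ = inj₁ refl
≢R-pair-exhaustive {G} {B} {B} _ _ _ _ = inj₂ refl
≢R-pair-exhaustive {B} {G} {B} _ _ _ _ = inj₁ refl
≢R-pair-exhaustive {B} {G} {G} _ _ _ _ = inj₂ refl
≢R-pair-exhaustive {R} a≢R _ _ _ = contradiction refl a≢R
≢R-pair-exhaustive {_} {R} _ b≢R _ _ = contradiction refl b≢R
≢R-pair-exhaustive {_} {_} {R} _ _ _ d≢R = contradiction refl d≢R
≢R-pair-exhaustive {G} {G} _ _ a≢b _ = contradiction refl a≢b
≢R-pair-exhaustive {B} {B} _ _ a≢b _ = contradiction refl a≢b

module _ {k : ℕ} {c : Coloring} (rf : RainbowFree k c)
         {a₁ a₂ a₃ : ℕ} (1≤a₁ : 1 ≤ a₁) (1≤a₂ : 1 ≤ a₂) (1≤a₃ : 1 ≤ a₃)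
         (a₁≡a₂+a₃^k : a₁ ≡ a₂ + a₃ ^ k) where

  rainbowFree-colours : ∀ {p q r} → c a₁ ≡ p → c a₂ ≡ q → c a₃ ≡ r →
                        p ≢ q → p ≢ r → q ≢ r → ⊥
  rainbowFree-colours refl refl refl p≢q p≢r q≢r =
    rf a₁ a₂ a₃ (1≤a₁ , 1≤a₂ , 1≤a₃ , a₁≡a₂+a₃^k , p≢q , p≢r , q≢r)

  minuend≢R : c a₂ ≡ G → c a₃ ≡ B → c a₁ ≢ R
  minuend≢R c₂≡G c₃≡B c₁≡R =
    rainbowFree-colours c₁≡R c₂≡G c₃≡B (λ ()) (λ ()) (λ ())

  subtrahend≢R : c a₁ ≡ G → c a₃ ≡ B → c a₂ ≢ R
  subtrahend≢R c₁≡G c₃≡B c₂≡R =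
    rainbowFree-colours c₁≡G c₂≡R c₃≡B (λ ()) (λ ()) (λ ())

inString-+ : ∀ {i ℓ x} n → InString i ℓ x → InString (i + n) ℓ (x + n)
inString-+ {i} {ℓ} {x} n (i≤x , x<i+ℓ) =
  +-monoˡ-≤ n i≤x , subst (x + n <_) (xy∙z≈xz∙y i ℓ n) (+-monoˡ-< n x<i+ℓ)

inString-+⁻ : ∀ {i ℓ x} n → InString (i + n) ℓ (x + n) → InString i ℓ x
inString-+⁻ {i} {ℓ} {x} n (i+n≤x+n , x+n<i+n+ℓ) =
  +-cancelʳ-≤ n i x i+n≤x+n ,
  +-cancelʳ-< n x (i + ℓ) (subst (x + n <_) (xy∙z≈xz∙y i n ℓ) x+n<i+n+ℓ)

module _ {c : Coloring} (dom : Dominant c R) {p ℓ : ℕ} (1≤p : 1 ≤ p) (1≤ℓ : 1 ≤ ℓ)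
         (avoidsR : ∀ x → InString p ℓ x → c x ≢ R) where

  private
    p∈ : InString p ℓ p
    p∈ = ≤-refl , m<m+n p 1≤ℓ

  avoidsR⇒monochromaticOf-first : MonochromaticOf c p ℓ (c p)
  avoidsR⇒monochromaticOf-first x x∈ with c x ≟ c p
  ... | yes cx≡cp = cx≡cp
  ... | no  cx≢cp = contradiction (dom p ℓ 1≤p bichromatic) λ (y , y∈ , cy≡R) → avoidsR y y∈ cy≡R
    where
    cp≢cx : c p ≢ c x
    cp≢cx cp≡cx = cx≢cp (sym cp≡cx)
    bichromatic : Bichromatic c p ℓ
    bichromatic = c p , c x , cp≢cx , (p , p∈ , refl) , (x , x∈ , refl) ,
      λ y y∈ → ≢R-pair-exhaustive (avoidsR p p∈) (avoidsR x x∈) cp≢cx (avoidsR y y∈)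

  avoidsR⇒monochromatic : MonochromaticOf c p ℓ B ⊎ MonochromaticOf c p ℓ G
  avoidsR⇒monochromatic with ≢R⇒≡B⊎≡G (avoidsR p p∈)
  ... | inj₁ cp≡B = inj₁ λ x x∈ → trans (avoidsR⇒monochromaticOf-first x x∈) cp≡B
  ... | inj₂ cp≡G = inj₂ λ x x∈ → trans (avoidsR⇒monochromaticOf-first x x∈) cp≡G

mainTheorem10 : (k : ℕ) → 2 ≤ k → (c : Coloring) → RainbowFree k c → Dominant c R →
    (j : ℕ) → 1 ≤ j → c j ≡ B → (i ℓ : ℕ) → 1 ≤ i → 1 ≤ ℓ → MonochromaticOf c i ℓ G →
    (MonochromaticOf c (i + j ^ k) ℓ B ⊎ MonochromaticOf c (i + j ^ k) ℓ G)
    × (1 ≤ i ∸ j ^ k → MonochromaticOf c (i ∸ j ^ k) ℓ B ⊎ MonochromaticOf c (i ∸ j ^ k) ℓ G)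
mainTheorem10 k _ c rf dom j 1≤j cj≡B i ℓ 1≤i 1≤ℓ green =
  avoidsR⇒monochromatic dom 1≤i+n 1≤ℓ above ,
  λ 1≤i∸n → avoidsR⇒monochromatic dom 1≤i∸n 1≤ℓ (below 1≤i∸n)
  where
  n = j ^ k

  1≤i+n : 1 ≤ i + n
  1≤i+n = ≤-trans 1≤i (m≤m+n i n)

  above : ∀ x → InString (i + n) ℓ x → c x ≢ R
  above x x∈@(i+n≤x , _) = minuend≢R {k = k} rf (≤-trans 1≤i+n i+n≤x)
    (≤-trans 1≤i (proj₁ x∸n∈)) 1≤j (sym x∸n+n≡x) (green (x ∸ n) x∸n∈) cj≡B
    where
    x∸n+n≡x : x ∸ n + n ≡ x
    x∸n+n≡x = m∸n+n≡m (≤-trans (m≤n+m n i) i+n≤x)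
    x∸n∈ : InString i ℓ (x ∸ n)
    x∸n∈ = inString-+⁻ n (subst (InString (i + n) ℓ) (sym x∸n+n≡x) x∈)

  below : 1 ≤ i ∸ n → ∀ x → InString (i ∸ n) ℓ x → c x ≢ R
  below 1≤i∸n x x∈@(i∸n≤x , _) = subtrahend≢R {k = k} rf (≤-trans 1≤i (proj₁ x+n∈))
    (≤-trans 1≤i∸n i∸n≤x) 1≤j refl (green (x + n) x+n∈) cj≡B
    where
    i∸n+n≡i : i ∸ n + n ≡ i
    i∸n+n≡i = m∸n+n≡m {i} {n} (<⇒≤ (m∸n≢0⇒n<m (n>0⇒n≢0 1≤i∸n)))
    x+n∈ : InString i ℓ (x + n)
    x+n∈ = subst (λ m → InString m ℓ (x + n)) i∸n+n≡i (inString-+ n x∈)
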